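{- Let $p$ be an odd prime, let $\Delta\in\mathbb{Z}$ with $\Delta\equiv3\pmod4$ be a quadratic non-residue modulo $p$, and let $\mathfrak{p}=p\mathbb{Z}[\sqrt{\Delta}]$. Let $$C_p=\prod_{1\le s<t\le p-1}\frac{1}{(t+\sqrt{\Delta})(s+\sqrt{\Delta})},$$ computed in the field $\mathbb{Z}[\sqrt{\Delta}]/\mathfrak{p}$. Then $$C_p^{\frac{p-1}{2}}\equiv\left(\frac{ -2}{p}\right)\pmod{\mathfrak{p}}.$$
   Context: $\left(\frac{\cdot}{p}\right)$ is the Legendre symbol. The elements $t+\sqrt{\Delta}$ ($1\le t\le p-1$) are nonzero in the field $\mathbb{Z}[\sqrt{\Delta}]/\mathfrak{p}\cong\mathbb{F}_{p^2}$, so the inverses make sense there. -}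

module Defs where

open import Data.Nat as ℕ using (ℕ; zero; suc)
open import Data.Nat.Divisibility as ℕD using ()
open import Data.Integer as ℤ using (ℤ; +_; -[1+_]; ∣_∣)
open import Data.Bool using (Bool; if_then_else_)
open import Data.Bool.ListAction using (any)
open import Data.List using (List; []; _∷_; upTo; foldr; map; concatMap; applyUpTo)
open import Data.Product using (_×_; _,_)
open import Relation.Nullary.Decidable using (⌊_⌋)

_∣ℤ_ : ℕ → ℤ → Set
p ∣ℤ a = p ℕD.∣ ∣ a ∣

legendre : ℤ → ℕ → ℤ
legendre a p =
  if ⌊ p ℕD.∣? ∣ a ∣ ⌋ then + 0
  else if any (λ x → ⌊ p ℕD.∣? ∣ (+ x) ℤ.* (+ x) ℤ.- a ∣ ⌋) (upTo p) then + 1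
  else -[1+ 0 ]

-- Elements of ℤ[√Δ], written a + b√Δ as the pair (a , b).
ZΔ : Set
ZΔ = ℤ × ℤ

embed : ℤ → ZΔ
embed a = (a , + 0)

oneZΔ : ZΔ
oneZΔ = embed (+ 1)

mulZΔ : ℤ → ZΔ → ZΔ → ZΔ
mulZΔ Δ (a , b) (c , d) = (a ℤ.* c ℤ.+ Δ ℤ.* b ℤ.* d , a ℤ.* d ℤ.+ b ℤ.* c)

powZΔ : ℤ → ZΔ → ℕ → ZΔ
powZΔ Δ x zero    = oneZΔ
powZΔ Δ x (suc n) = mulZΔ Δ x (powZΔ Δ x n)

prodZΔ : ℤ → List ZΔ → ZΔ
prodZΔ Δ = foldr (mulZΔ Δ) oneZΔ

tPlusSqrtΔ : ℕ → ZΔ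
tPlusSqrtΔ t = (+ t , + 1)

-- Congruence modulo the ideal 𝔭 = p ℤ[√Δ] (which has ℤ-basis p, p√Δ):
-- a + b√Δ ≡ c + d√Δ (mod 𝔭)  iff  p ∣ a - c  and  p ∣ b - d.
_≡_[mod𝔭_] : ZΔ → ZΔ → ℕ → Set
(a , b) ≡ (c , d) [mod𝔭 p ] = (p ∣ℤ (a ℤ.- c)) × (p ∣ℤ (b ℤ.- d))

pairsBelow : ℕ → List (ℕ × ℕ)
pairsBelow p = concatMap (λ t → map (λ s → (s , t)) (applyUpTo suc (ℕ.pred t)))
                         (applyUpTo suc (ℕ.pred p))

-- C_p = ∏_{1 ≤ s < t ≤ p-1} (t+√Δ)⁻¹ (s+√Δ)⁻¹, where inv t stands for a chosen
-- inverse of t + √Δ modulo 𝔭.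
Cp : ℤ → ℕ → (ℕ → ZΔ) → ZΔ
Cp Δ p inv = prodZΔ Δ (map (λ { (s , t) → mulZΔ Δ (inv t) (inv s) }) (pairsBelow p))

module Submission where

-- Let p = 2h + 1 be an odd prime and Δ a non-residue modulo p.  We work in
-- ℤ[√Δ]/𝔭, represented by the pairs ZΔ up to componentwise congruence
-- modulo p, which is a commutative ring; ring identities are normalised
-- with the standard-library ring solver (integer coefficients).
--
--  1. For p prime, x ↦ x^p is additive (p divides the middle binomial
--     coefficients), so a^p = a for integers a (Fermat).
--  2. A polynomial with at most n coefficients vanishing at n points with
--     pairwise regular differences is zero (root counting).
--  3. Euler's criterion a^h = (a / p): X^h - 1 has the roots 1², …, h², so
--     a non-residue c is not a root, while (c^h)² = 1 forces c^h = ±1.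
--  4. ∏_{t<p} (x + t) = x^p - x (root counting at 0, …, p - 1).  At x = √Δ,
--     where √Δ^p = Δ^h √Δ = -√Δ, this gives ∏_{t=1}^{p-1} (t + √Δ) = -2.
--  5. Counting factors, C_p = J^(p-2) with J = ∏_{t=1}^{p-1} (t + √Δ)⁻¹,
--     the inverse of -2.  Hence J^h is the inverse of (-2)^h = (-2 / p) = ±1,
--     i.e. J^h = (-2 / p), and C_p^h = (-2 / p)^(p-2) = (-2 / p), p - 2 odd.

open import Defs
open import Level using (0ℓ)
open import Data.Bool using (Bool; true; false; T)
open import Data.Bool.ListAction using (any)
open import Data.Empty using (⊥-elim)
open import Data.Fin as Fin using (Fin; toℕ; fromℕ; inject₁)
import Data.Fin.Properties as FinP
open import Data.Integer as ℤ using (ℤ; +_; -[1+_]; ∣_∣)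
import Data.Integer.Properties as ℤP
open import Data.Integer.Divisibility.Signed
  using (_∣_; divides; ∣ᵤ⇒∣; ∣⇒∣ᵤ; ∣m∣n⇒∣m+n; ∣m∣n⇒∣m-n; ∣n⇒∣m*n; ∣m⇒∣-m)
open import Data.Integer.Tactic.RingSolver using (solve-∀)
open import Data.List using (List; []; _∷_; _++_; [_]; length; map; foldr; concatMap; applyUpTo; upTo)
import Data.List.Properties as LP
open import Data.List.Membership.Propositional using (find; lose)
open import Data.List.Membership.Propositional.Properties using (∈-upTo⁺)
open import Data.List.Relation.Unary.All as All using (All; []; _∷_)
import Data.List.Relation.Unary.All.Properties as AllP
open import Data.List.Relation.Unary.AllPairs using (AllPairs; []; _∷_)
import Data.List.Relation.Unary.AllPairs.Properties as AllPairsP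
open import Data.List.Relation.Unary.Any.Properties using (any⁺; any⁻)
open import Data.Maybe using (Maybe; just; nothing)
open import Data.Nat as ℕ using (ℕ; zero; suc; _!; _≤_; _<_; _∸_; _/_; _%_)
import Data.Nat.Properties as ℕP
import Data.Nat.Divisibility as ℕD
open import Data.Nat.DivMod using (m/n*n≡m; m*n/n≡m; m≡m%n+[m/n]*n; m%n<n)
open import Data.Nat.Combinatorics using (_C_; nCk≡n!/k![n-k]!; k![n∸k]!∣n!; nCn≡1)
open import Data.Nat.Primality using (Prime; euclidsLemma; prime⇒nonTrivial; prime⇒irreducible)
open import Data.Product using (_×_; _,_; proj₁; proj₂; ∃-syntax)
open import Data.Sum using (_⊎_; inj₁; inj₂; [_,_]′)
open import Relation.Nullary using (¬_; yes; no)
open import Relation.Nullary.Decidable using (⌊_⌋; toWitness; fromWitness)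
open import Relation.Binary.PropositionalEquality
  using (_≡_; _≢_; refl; sym; trans; cong; cong₂; subst)
open import Algebra.Bundles using (CommutativeRing; RawRing)
open import Algebra.Structures using (IsCommutativeRing)
open import Algebra.Solver.Ring.AlmostCommutativeRing
  using (fromCommutativeRing; _-Raw-AlmostCommutative⟶_)

module IntegersModulo (p : ℕ) where

  infix 4 p∣_ _≡ₚ_
  p∣_ : ℤ → Set
  p∣ a = + p ∣ a

  NonSquare : ℤ → Set
  NonSquare a = ∀ x → x ℕ.< p → ¬ (p∣ + x ℤ.* + x ℤ.- a)

  record _≡ₚ_ (a b : ℤ) : Set where
    constructor modp
    field divides-diff : p∣ a ℤ.- b

  ≡ₚ-reflexive : ∀ {a b} → a ≡ b → a ≡ₚ b
  ≡ₚ-reflexive {a} refl = modp (divides (+ 0) (ℤP.+-inverseʳ a))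

  ≡ₚ-sym : ∀ {a b} → a ≡ₚ b → b ≡ₚ a
  ≡ₚ-sym {a} {b} (modp d) = modp (subst p∣_ (negate-diff a b) (∣m⇒∣-m d))
    where
    negate-diff : ∀ a b → ℤ.- (a ℤ.- b) ≡ b ℤ.- a
    negate-diff = solve-∀

  ≡ₚ-trans : ∀ {a b c} → a ≡ₚ b → b ≡ₚ c → a ≡ₚ c
  ≡ₚ-trans {a} {b} {c} (modp d) (modp e) = modp (subst p∣_ (telescope a b c) (∣m∣n⇒∣m+n d e))
    where
    telescope : ∀ a b c → (a ℤ.- b) ℤ.+ (b ℤ.- c) ≡ a ℤ.- c
    telescope = solve-∀

  +-cong : ∀ {a a' b b'} → a ≡ₚ a' → b ≡ₚ b' → a ℤ.+ b ≡ₚ a' ℤ.+ b'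
  +-cong {a} {a'} {b} {b'} (modp d) (modp e) = modp (subst p∣_ (split a a' b b') (∣m∣n⇒∣m+n d e))
    where
    split : ∀ a a' b b' → (a ℤ.- a') ℤ.+ (b ℤ.- b') ≡ (a ℤ.+ b) ℤ.- (a' ℤ.+ b')
    split = solve-∀

  neg-cong : ∀ {a a'} → a ≡ₚ a' → ℤ.- a ≡ₚ ℤ.- a'
  neg-cong {a} {a'} (modp d) = modp (subst p∣_ (split a a') (∣m⇒∣-m d))
    where
    split : ∀ a a' → ℤ.- (a ℤ.- a') ≡ ℤ.- a ℤ.- ℤ.- a'
    split = solve-∀

  *-cong : ∀ {a a' b b'} → a ≡ₚ a' → b ≡ₚ b' → a ℤ.* b ≡ₚ a' ℤ.* b'
  *-cong {a} {a'} {b} {b'} (modp d) (modp e) =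
    modp (subst p∣_ (split a a' b b') (∣m∣n⇒∣m+n (∣n⇒∣m*n b d) (∣n⇒∣m*n a' e)))
    where
    split : ∀ a a' b b' → b ℤ.* (a ℤ.- a') ℤ.+ a' ℤ.* (b ℤ.- b') ≡ a ℤ.* b ℤ.- a' ℤ.* b'
    split = solve-∀

  ≡ₚ⇒∣ℤ : ∀ {a b} → a ≡ₚ b → p ∣ℤ (a ℤ.- b)
  ≡ₚ⇒∣ℤ (modp d) = ∣⇒∣ᵤ d

  ∣ℤ⇒≡ₚ : ∀ {a b} → p ∣ℤ (a ℤ.- b) → a ≡ₚ b
  ∣ℤ⇒≡ₚ d = modp (∣ᵤ⇒∣ d)

-- Its operations
-- are made opaque so that the ring solver, whose coefficients are
-- integers embedded by `embed`, compares normal forms symbolically.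
module QuotientRing (p : ℕ) (Δ : ℤ) where

  open IntegersModulo p public

  infix 4 _≈_
  record _≈_ (x y : ZΔ) : Set where
    constructor _,_
    field
      re : proj₁ x ≡ₚ proj₁ y
      im : proj₂ x ≡ₚ proj₂ y

  ≈-reflexive : ∀ {x y} → x ≡ y → x ≈ y
  ≈-reflexive refl = ≡ₚ-reflexive refl , ≡ₚ-reflexive refl

  ≈-refl : ∀ {x} → x ≈ x
  ≈-refl = ≈-reflexive refl

  ≈-sym : ∀ {x y} → x ≈ y → y ≈ x
  ≈-sym (r , i) = ≡ₚ-sym r , ≡ₚ-sym i

  ≈-trans : ∀ {x y z} → x ≈ y → y ≈ z → x ≈ z
  ≈-trans (r , i) (r' , i') = ≡ₚ-trans r r' , ≡ₚ-trans i i'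

  ≈⇒mod𝔭 : ∀ {x y} → x ≈ y → x ≡ y [mod𝔭 p ]
  ≈⇒mod𝔭 (r , i) = ≡ₚ⇒∣ℤ r , ≡ₚ⇒∣ℤ i

  mod𝔭⇒≈ : ∀ {x y} → x ≡ y [mod𝔭 p ] → x ≈ y
  mod𝔭⇒≈ (r , i) = ∣ℤ⇒≡ₚ r , ∣ℤ⇒≡ₚ i

  zeroZΔ : ZΔ
  zeroZΔ = embed (+ 0)

  √Δ : ZΔ
  √Δ = (+ 0 , + 1)

  private module Exact where
    addZΔ : ZΔ → ZΔ → ZΔ
    addZΔ (a , b) (c , d) = (a ℤ.+ c , b ℤ.+ d)

    negZΔ : ZΔ → ZΔ
    negZΔ (a , b) = (ℤ.- a , ℤ.- b)

    pair : ∀ {a b c d : ℤ} → a ≡ c → b ≡ d → (a , b) ≡ (c , d)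
    pair = cong₂ _,_

    *-assoc : ∀ x y z → mulZΔ Δ (mulZΔ Δ x y) z ≡ mulZΔ Δ x (mulZΔ Δ y z)
    *-assoc (a , b) (c , d) (e , f) = pair (re Δ a b c d e f) (im Δ a b c d e f)
      where
      re : ∀ D a b c d e f →
        (a ℤ.* c ℤ.+ D ℤ.* b ℤ.* d) ℤ.* e ℤ.+ D ℤ.* (a ℤ.* d ℤ.+ b ℤ.* c) ℤ.* f
        ≡ a ℤ.* (c ℤ.* e ℤ.+ D ℤ.* d ℤ.* f) ℤ.+ D ℤ.* b ℤ.* (c ℤ.* f ℤ.+ d ℤ.* e)
      re = solve-∀
      im : ∀ D a b c d e f →
        (a ℤ.* c ℤ.+ D ℤ.* b ℤ.* d) ℤ.* f ℤ.+ (a ℤ.* d ℤ.+ b ℤ.* c) ℤ.* e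
        ≡ a ℤ.* (c ℤ.* f ℤ.+ d ℤ.* e) ℤ.+ b ℤ.* (c ℤ.* e ℤ.+ D ℤ.* d ℤ.* f)
      im = solve-∀

    *-comm : ∀ x y → mulZΔ Δ x y ≡ mulZΔ Δ y x
    *-comm (a , b) (c , d) = pair (re Δ a b c d) (im a b c d)
      where
      re : ∀ D a b c d → a ℤ.* c ℤ.+ D ℤ.* b ℤ.* d ≡ c ℤ.* a ℤ.+ D ℤ.* d ℤ.* b
      re = solve-∀
      im : ∀ a b c d → a ℤ.* d ℤ.+ b ℤ.* c ≡ c ℤ.* b ℤ.+ d ℤ.* a
      im = solve-∀

    *-identityˡ : ∀ x → mulZΔ Δ oneZΔ x ≡ x
    *-identityˡ (a , b) = pair (re Δ a b) (im a b)
      where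
      re : ∀ D a b → + 1 ℤ.* a ℤ.+ D ℤ.* + 0 ℤ.* b ≡ a
      re = solve-∀
      im : ∀ a b → + 1 ℤ.* b ℤ.+ + 0 ℤ.* a ≡ b
      im = solve-∀

    *-distribˡ : ∀ x y z → mulZΔ Δ x (addZΔ y z) ≡ addZΔ (mulZΔ Δ x y) (mulZΔ Δ x z)
    *-distribˡ (a , b) (c , d) (e , f) = pair (re Δ a b c d e f) (im a b c d e f)
      where
      re : ∀ D a b c d e f → a ℤ.* (c ℤ.+ e) ℤ.+ D ℤ.* b ℤ.* (d ℤ.+ f)
         ≡ (a ℤ.* c ℤ.+ D ℤ.* b ℤ.* d) ℤ.+ (a ℤ.* e ℤ.+ D ℤ.* b ℤ.* f)
      re = solve-∀
      im : ∀ a b c d e f → a ℤ.* (d ℤ.+ f) ℤ.+ b ℤ.* (c ℤ.+ e)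
         ≡ (a ℤ.* d ℤ.+ b ℤ.* c) ℤ.+ (a ℤ.* f ℤ.+ b ℤ.* e)
      im = solve-∀

    embed-* : ∀ a b → mulZΔ Δ (embed a) (embed b) ≡ embed (a ℤ.* b)
    embed-* a b = pair (re Δ a b) (im a b)
      where
      re : ∀ D a b → a ℤ.* b ℤ.+ D ℤ.* + 0 ℤ.* + 0 ≡ a ℤ.* b
      re = solve-∀
      im : ∀ a b → a ℤ.* + 0 ℤ.+ + 0 ℤ.* b ≡ + 0
      im = solve-∀

  infixl 6 _⊕_
  infixl 7 _⊛_
  infix 8 ⊖_
  opaque
    _⊕_ : ZΔ → ZΔ → ZΔ
    _⊕_ = Exact.addZΔ
    ⊖_ : ZΔ → ZΔ
    ⊖_ = Exact.negZΔ
    _⊛_ : ZΔ → ZΔ → ZΔ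
    _⊛_ = mulZΔ Δ

  opaque
    unfolding _⊕_ ⊖_ _⊛_

    ⊛-unfold : ∀ x y → x ⊛ y ≡ mulZΔ Δ x y
    ⊛-unfold x y = refl

    embed-+ : ∀ a b → embed a ⊕ embed b ≡ embed (a ℤ.+ b)
    embed-+ a b = refl

    embed-neg : ∀ a → ⊖ embed a ≡ embed (ℤ.- a)
    embed-neg a = refl

    embed-* : ∀ a b → embed a ⊛ embed b ≡ embed (a ℤ.* b)
    embed-* = Exact.embed-*

    tPlusSqrtΔ-≡ : ∀ t → √Δ ⊕ embed (+ t) ≡ tPlusSqrtΔ t
    tPlusSqrtΔ-≡ t = refl

    √Δ-squared : √Δ ⊛ √Δ ≡ embed Δ
    √Δ-squared = Exact.pair (re Δ) refl
      where
      re : ∀ D → + 0 ℤ.* + 0 ℤ.+ D ℤ.* + 1 ℤ.* + 1 ≡ D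
      re = solve-∀

    ⊕-cong : ∀ {x x' y y'} → x ≈ x' → y ≈ y' → x ⊕ y ≈ x' ⊕ y'
    ⊕-cong (r , i) (r' , i') = +-cong r r' , +-cong i i'

    ⊖-cong : ∀ {x x'} → x ≈ x' → ⊖ x ≈ ⊖ x'
    ⊖-cong (r , i) = neg-cong r , neg-cong i

    ⊛-cong : ∀ {x x' y y'} → x ≈ x' → y ≈ y' → x ⊛ y ≈ x' ⊛ y'
    ⊛-cong (r , i) (r' , i') =
      +-cong (*-cong r r') (*-cong (*-cong (≡ₚ-reflexive {Δ} refl) i) i') ,
      +-cong (*-cong r i') (*-cong i r')

    isCommutativeRing : IsCommutativeRing _≈_ _⊕_ _⊛_ ⊖_ zeroZΔ oneZΔ
    isCommutativeRing = record
      { isRing = record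
        { +-isAbelianGroup = record
          { isGroup = record
            { isMonoid = record
              { isSemigroup = record
                { isMagma = record
                  { isEquivalence = record { refl = ≈-refl ; sym = ≈-sym ; trans = ≈-trans }
                  ; ∙-cong = ⊕-cong }
                ; assoc = λ x y z → exact (ℤP.+-assoc (proj₁ x) (proj₁ y) (proj₁ z))
                                        (ℤP.+-assoc (proj₂ x) (proj₂ y) (proj₂ z)) }
              ; identity = (λ x → exact (ℤP.+-identityˡ (proj₁ x)) (ℤP.+-identityˡ (proj₂ x)))
                         , (λ x → exact (ℤP.+-identityʳ (proj₁ x)) (ℤP.+-identityʳ (proj₂ x))) }
            ; inverse = (λ x → exact (ℤP.+-inverseˡ (proj₁ x)) (ℤP.+-inverseˡ (proj₂ x)))
                      , (λ x → exact (ℤP.+-inverseʳ (proj₁ x)) (ℤP.+-inverseʳ (proj₂ x)))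
            ; ⁻¹-cong = ⊖-cong }
          ; comm = λ x y → exact (ℤP.+-comm (proj₁ x) (proj₁ y)) (ℤP.+-comm (proj₂ x) (proj₂ y)) }
        ; *-cong = ⊛-cong
        ; *-assoc = λ x y z → ≈-reflexive (Exact.*-assoc x y z)
        ; *-identity = (λ x → ≈-reflexive (Exact.*-identityˡ x))
                     , (λ x → ≈-reflexive (trans (Exact.*-comm x oneZΔ) (Exact.*-identityˡ x)))
        ; distrib = (λ x y z → ≈-reflexive (Exact.*-distribˡ x y z))
                  , (λ x y z → ≈-reflexive (trans (Exact.*-comm (y ⊕ z) x)
                       (trans (Exact.*-distribˡ x y z)
                         (cong₂ _⊕_ (Exact.*-comm x y) (Exact.*-comm x z))))) }
      ; *-comm = λ x y → ≈-reflexive (Exact.*-comm x y) }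
      where
      exact : ∀ {a b c d} → a ≡ c → b ≡ d → (a , b) ≈ (c , d)
      exact e e' = ≈-reflexive (Exact.pair e e')

  ring : CommutativeRing 0ℓ 0ℓ
  ring = record { isCommutativeRing = isCommutativeRing }

  private
    ℤ-rawRing : RawRing 0ℓ 0ℓ
    ℤ-rawRing = CommutativeRing.rawRing ℤP.+-*-commutativeRing

    embed-homomorphism : ℤ-rawRing -Raw-AlmostCommutative⟶ fromCommutativeRing ring
    embed-homomorphism = record
      { ⟦_⟧ = embed
      ; +-homo = λ a b → ≈-reflexive (sym (embed-+ a b))
      ; *-homo = λ a b → ≈-reflexive (sym (embed-* a b))
      ; -‿homo = λ a → ≈-reflexive (sym (embed-neg a))
      ; 0-homo = ≈-refl
      ; 1-homo = ≈-refl }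

    embed-≟ : ∀ a b → Maybe (embed a ≈ embed b)
    embed-≟ a b with a ℤ.≟ b
    ... | yes a≡b = just (≈-reflexive (cong embed a≡b))
    ... | no _ = nothing

  open import Algebra.Solver.Ring ℤ-rawRing (fromCommutativeRing ring) embed-homomorphism embed-≟
    public using (solve; _:=_; _:+_; _:*_; :-_; _:-_; con)

  open CommutativeRing ring public using (setoid; semiring; commutativeSemiring)
  open import Algebra.Properties.CommutativeSemiring.Exp commutativeSemiring public
    using (_^_; ^-homo-*; ^-assocʳ; ^-distrib-*; ^-congˡ)
  open import Relation.Binary.Reasoning.Setoid setoid

  difference≈0 : ∀ {x y} → x ⊕ ⊖ y ≈ zeroZΔ → x ≈ y
  difference≈0 {x} {y} x-y≈0 =
    ≈-trans (solve 2 (λ x y → x := (x :- y) :+ y) ≈-refl x y)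
      (≈-trans (⊕-cong x-y≈0 ≈-refl) (solve 1 (λ y → con (+ 0) :+ y := y) ≈-refl y))

  ≈⇒difference≈0 : ∀ {x y} → x ≈ y → x ⊕ ⊖ y ≈ zeroZΔ
  ≈⇒difference≈0 {x} {y} x≈y = ≈-trans (⊕-cong x≈y ≈-refl) (solve 1 (λ y → y :- y := con (+ 0)) ≈-refl y)

  one^ : ∀ n → oneZΔ ^ n ≈ oneZΔ
  one^ zero = ≈-refl
  one^ (suc n) = ≈-trans (⊛-cong ≈-refl (one^ n)) (solve 0 (con (+ 1) :* con (+ 1) := con (+ 1)) ≈-refl)

  ^-double : ∀ x n → (x ⊛ x) ^ n ≈ x ^ (n ℕ.+ n)
  ^-double x n = ≈-trans (^-distrib-* x x n) (≈-sym (^-homo-* x n n))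

  ^-swap : ∀ x a b → (x ^ a) ^ b ≈ (x ^ b) ^ a
  ^-swap x a b = begin
    (x ^ a) ^ b      ≈⟨ ^-assocʳ x a b ⟩
    x ^ (a ℕ.* b)    ≈⟨ ≈-reflexive (cong (x ^_) (ℕP.*-comm a b)) ⟩
    x ^ (b ℕ.* a)    ≈⟨ ^-assocʳ x b a ⟨
    (x ^ b) ^ a      ∎

  embed-^ : ∀ a n → embed a ^ n ≈ embed (a ℤ.^ n)
  embed-^ a zero = ≈-refl
  embed-^ a (suc n) = ≈-trans (⊛-cong ≈-refl (embed-^ a n)) (≈-reflexive (embed-* a (a ℤ.^ n)))

  inverse-unique : ∀ {x y} → x ⊛ y ≈ oneZΔ → y ⊛ y ≈ oneZΔ → x ≈ y
  inverse-unique {x} {y} xy≈1 yy≈1 = begin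
    x                ≈⟨ solve 1 (λ x → x := x :* con (+ 1)) ≈-refl x ⟩
    x ⊛ oneZΔ        ≈⟨ ⊛-cong ≈-refl yy≈1 ⟨
    x ⊛ (y ⊛ y)      ≈⟨ solve 2 (λ x y → x :* (y :* y) := (x :* y) :* y) ≈-refl x y ⟩
    (x ⊛ y) ⊛ y      ≈⟨ ⊛-cong xy≈1 ≈-refl ⟩
    oneZΔ ⊛ y        ≈⟨ solve 1 (λ y → con (+ 1) :* y := y) ≈-refl y ⟩
    y                ∎

  odd-power : ∀ {x} → x ⊛ x ≈ oneZΔ → ∀ j → x ^ suc (j ℕ.+ j) ≈ x
  odd-power {x} xx≈1 j = begin
    x ⊛ x ^ (j ℕ.+ j)   ≈⟨ ⊛-cong ≈-refl (^-double x j) ⟨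
    x ⊛ (x ⊛ x) ^ j     ≈⟨ ⊛-cong ≈-refl (≈-trans (^-congˡ j xx≈1) (one^ j)) ⟩
    x ⊛ oneZΔ           ≈⟨ solve 1 (λ x → x :* con (+ 1) := x) ≈-refl x ⟩
    x                   ∎

-- Polynomials over ℤ[√Δ]/p as coefficient lists, lowest degree first, and
-- the fact that a polynomial with more roots than its degree is zero,
-- provided the roots are pairwise apart (their differences are regular).
module Polynomials (p : ℕ) (Δ : ℤ) where

  open QuotientRing p Δ
  open import Relation.Binary.Reasoning.Setoid setoid

  Regular : ZΔ → Set
  Regular z = ∀ y → z ⊛ y ≈ zeroZΔ → y ≈ zeroZΔ

  Regular-resp : ∀ {z z'} → z ≈ z' → Regular z → Regular z'
  Regular-resp z≈z' reg y z'y≈0 = reg y (≈-trans (⊛-cong z≈z' ≈-refl) z'y≈0)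

  Apart : ZΔ → ZΔ → Set
  Apart r s = Regular (s ⊕ ⊖ r)

  eval : List ZΔ → ZΔ → ZΔ
  eval [] x = zeroZΔ
  eval (a ∷ f) x = a ⊕ x ⊛ eval f x

  IsZero : List ZΔ → Set
  IsZero = All (_≈ zeroZΔ)

  divide : ZΔ → ZΔ → List ZΔ → List ZΔ × ZΔ
  divide r a [] = ([] , a)
  divide r a (b ∷ f) =
    (proj₂ (divide r b f) ∷ proj₁ (divide r b f) , a ⊕ r ⊛ proj₂ (divide r b f))

  quotient-length : ∀ r a f → length (proj₁ (divide r a f)) ≡ length f
  quotient-length r a [] = refl
  quotient-length r a (b ∷ f) = cong suc (quotient-length r b f)

  division : ∀ r a f x →
    eval (a ∷ f) x ≈ (x ⊕ ⊖ r) ⊛ eval (proj₁ (divide r a f)) x ⊕ proj₂ (divide r a f)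
  division r a [] x =
    solve 3 (λ a x r → a :+ x :* con (+ 0) := (x :- r) :* con (+ 0) :+ a) ≈-refl a x r
  division r a (b ∷ f) x = begin
    a ⊕ x ⊛ eval (b ∷ f) x                   ≈⟨ ⊕-cong ≈-refl (⊛-cong ≈-refl (division r b f x)) ⟩
    a ⊕ x ⊛ ((x ⊕ ⊖ r) ⊛ eval q x ⊕ c)
      ≈⟨ solve 5 (λ a x r Q c → a :+ x :* ((x :- r) :* Q :+ c)
                              := (x :- r) :* (c :+ x :* Q) :+ (a :+ r :* c)) ≈-refl a x r (eval q x) c ⟩
    (x ⊕ ⊖ r) ⊛ (c ⊕ x ⊛ eval q x) ⊕ (a ⊕ r ⊛ c) ∎
    where
    q : List ZΔ
    q = proj₁ (divide r b f)
    c : ZΔ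
    c = proj₂ (divide r b f)

  remainder≈value : ∀ r a f → proj₂ (divide r a f) ≈ eval (a ∷ f) r
  remainder≈value r a f = begin
    c                                      ≈⟨ solve 3 (λ r Q c → c := (r :- r) :* Q :+ c) ≈-refl r (eval q r) c ⟩
    (r ⊕ ⊖ r) ⊛ eval q r ⊕ c               ≈⟨ division r a f r ⟨
    eval (a ∷ f) r                         ∎
    where
    q : List ZΔ
    q = proj₁ (divide r a f)
    c : ZΔ
    c = proj₂ (divide r a f)

  zero-division : ∀ r a f → IsZero (proj₁ (divide r a f)) → proj₂ (divide r a f) ≈ zeroZΔ →
    IsZero (a ∷ f)
  zero-division r a [] _ a≈0 = a≈0 ∷ []
  zero-division r a (b ∷ f) (c≈0 ∷ q≈0) rem≈0 = a≈0 ∷ zero-division r b f q≈0 c≈0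
    where
    c : ZΔ
    c = proj₂ (divide r b f)
    a≈0 : a ≈ zeroZΔ
    a≈0 = begin
      a                          ≈⟨ solve 3 (λ a r c → a := (a :+ r :* c) :- r :* c) ≈-refl a r c ⟩
      (a ⊕ r ⊛ c) ⊕ ⊖ (r ⊛ c)    ≈⟨ ⊕-cong rem≈0 (⊖-cong (⊛-cong ≈-refl c≈0)) ⟩
      zeroZΔ ⊕ ⊖ (r ⊛ zeroZΔ)    ≈⟨ solve 1 (λ r → con (+ 0) :- r :* con (+ 0) := con (+ 0)) ≈-refl r ⟩
      zeroZΔ                     ∎

  -- Divide by X - r for the first root r;
  -- the quotient vanishes at the remaining roots s because s - r is regular.
  root-counting : ∀ rs f → length f ≤ length rs → AllPairs Apart rs →
    All (λ r → eval f r ≈ zeroZΔ) rs → IsZero f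
  root-counting rs [] _ _ _ = []
  root-counting (r ∷ rs) (a ∷ f) (ℕ.s≤s len≤) (apart ∷ distinct) (root ∷ roots) =
    zero-division r a f
      (root-counting rs q (subst (_≤ length rs) (sym (quotient-length r a f)) len≤) distinct
        (All.zipWith (λ {s} (apart-s , root-s) → quotient-root s apart-s root-s) (apart , roots)))
      rem≈0
    where
    q : List ZΔ
    q = proj₁ (divide r a f)
    c : ZΔ
    c = proj₂ (divide r a f)
    rem≈0 : c ≈ zeroZΔ
    rem≈0 = ≈-trans (remainder≈value r a f) root
    quotient-root : ∀ s → Apart r s → eval (a ∷ f) s ≈ zeroZΔ → eval q s ≈ zeroZΔ
    quotient-root s reg fs≈0 = reg (eval q s) (begin
      (s ⊕ ⊖ r) ⊛ eval q s                     ≈⟨ solve 2 (λ u c → u := (u :+ c) :- c) ≈-refl _ c ⟩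
      ((s ⊕ ⊖ r) ⊛ eval q s ⊕ c) ⊕ ⊖ c         ≈⟨ ⊕-cong (≈-trans (≈-sym (division r a f s)) fs≈0) (⊖-cong rem≈0) ⟩
      zeroZΔ ⊕ ⊖ zeroZΔ                        ≈⟨ solve 0 (con (+ 0) :- con (+ 0) := con (+ 0)) ≈-refl ⟩
      zeroZΔ                                   ∎)

  eval-zero : ∀ f x → IsZero f → eval f x ≈ zeroZΔ
  eval-zero [] x _ = ≈-refl
  eval-zero (a ∷ f) x (a≈0 ∷ f≈0) = begin
    a ⊕ x ⊛ eval f x         ≈⟨ ⊕-cong a≈0 (⊛-cong ≈-refl (eval-zero f x f≈0)) ⟩
    zeroZΔ ⊕ x ⊛ zeroZΔ      ≈⟨ solve 1 (λ x → con (+ 0) :+ x :* con (+ 0) := con (+ 0)) ≈-refl x ⟩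
    zeroZΔ                   ∎

  addConst : ZΔ → List ZΔ → List ZΔ
  addConst c [] = c ∷ []
  addConst c (a ∷ f) = (c ⊕ a) ∷ f

  addConst-eval : ∀ c f x → eval (addConst c f) x ≈ c ⊕ eval f x
  addConst-eval c [] x = solve 2 (λ c x → c :+ x :* con (+ 0) := c :+ con (+ 0)) ≈-refl c x
  addConst-eval c (a ∷ f) x =
    solve 4 (λ c a x w → (c :+ a) :+ x :* w := c :+ (a :+ x :* w)) ≈-refl c a x (eval f x)

  addConst-length : ∀ c f → length (addConst c f) ≡ suc (ℕ.pred (length f))
  addConst-length c [] = refl
  addConst-length c (a ∷ f) = refl

  monomial : ℕ → List ZΔ
  monomial zero = oneZΔ ∷ []
  monomial (suc n) = zeroZΔ ∷ monomial n

  monomial-length : ∀ n → length (monomial n) ≡ suc n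
  monomial-length zero = refl
  monomial-length (suc n) = cong suc (monomial-length n)

  monomial-eval : ∀ n x → eval (monomial n) x ≈ x ^ n
  monomial-eval zero x = solve 1 (λ x → con (+ 1) :+ x :* con (+ 0) := con (+ 1)) ≈-refl x
  monomial-eval (suc n) x = begin
    zeroZΔ ⊕ x ⊛ eval (monomial n) x   ≈⟨ ⊕-cong ≈-refl (⊛-cong ≈-refl (monomial-eval n x)) ⟩
    zeroZΔ ⊕ x ⊛ x ^ n                 ≈⟨ solve 2 (λ x w → con (+ 0) :+ x :* w := x :* w) ≈-refl x (x ^ n) ⟩
    x ⊛ x ^ n                          ∎

  monomial-nonzero : ∀ n → IsZero (monomial n) → oneZΔ ≈ zeroZΔ
  monomial-nonzero zero (1≈0 ∷ _) = 1≈0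
  monomial-nonzero (suc n) (_ ∷ rest) = monomial-nonzero n rest

  monomial+const-nonzero : ∀ c n → 1 ≤ n → IsZero (addConst c (monomial n)) → oneZΔ ≈ zeroZΔ
  monomial+const-nonzero c (suc n) _ (_ ∷ rest) = monomial-nonzero n rest

-- Finite products in ℤ[√Δ]/p, and the count of factors in C_p: each t
-- occurs in t - 1 pairs (s , t) as the larger entry and in p - 1 - t as
-- the smaller one, so C_p is the (p - 2)-th power of ∏_{t=1}^{p-1} inv t.
module Products (p : ℕ) (Δ : ℤ) where

  open QuotientRing p Δ
  open import Relation.Binary.Reasoning.Setoid setoid

  ∏₁ : ℕ → (ℕ → ZΔ) → ZΔ
  ∏₁ zero f = oneZΔ
  ∏₁ (suc n) f = f (suc n) ⊛ ∏₁ n f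

  ∏₁-inverse : ∀ n f g → (∀ t → 1 ≤ t → t ≤ n → f t ⊛ g t ≈ oneZΔ) → ∏₁ n f ⊛ ∏₁ n g ≈ oneZΔ
  ∏₁-inverse zero f g _ = solve 0 (con (+ 1) :* con (+ 1) := con (+ 1)) ≈-refl
  ∏₁-inverse (suc n) f g inverse = begin
    (f (suc n) ⊛ ∏₁ n f) ⊛ (g (suc n) ⊛ ∏₁ n g)
      ≈⟨ solve 4 (λ a F b G → (a :* F) :* (b :* G) := (a :* b) :* (F :* G)) ≈-refl
           (f (suc n)) (∏₁ n f) (g (suc n)) (∏₁ n g) ⟩
    (f (suc n) ⊛ g (suc n)) ⊛ (∏₁ n f ⊛ ∏₁ n g)
      ≈⟨ ⊛-cong (inverse (suc n) (ℕ.s≤s ℕ.z≤n) ℕP.≤-refl)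
                (∏₁-inverse n f g (λ t 1≤t t≤n → inverse t 1≤t (ℕP.m≤n⇒m≤1+n t≤n))) ⟩
    oneZΔ ⊛ oneZΔ
      ≈⟨ solve 0 (con (+ 1) :* con (+ 1) := con (+ 1)) ≈-refl ⟩
    oneZΔ ∎

  ∏₁-scale : ∀ n a f → ∏₁ n (λ s → a ⊛ f s) ≈ a ^ n ⊛ ∏₁ n f
  ∏₁-scale zero a f = solve 0 (con (+ 1) := con (+ 1) :* con (+ 1)) ≈-refl
  ∏₁-scale (suc n) a f = begin
    (a ⊛ f (suc n)) ⊛ ∏₁ n (λ s → a ⊛ f s)  ≈⟨ ⊛-cong ≈-refl (∏₁-scale n a f) ⟩
    (a ⊛ f (suc n)) ⊛ (a ^ n ⊛ ∏₁ n f)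
      ≈⟨ solve 4 (λ a b A F → (a :* b) :* (A :* F) := (a :* A) :* (b :* F)) ≈-refl
           a (f (suc n)) (a ^ n) (∏₁ n f) ⟩
    (a ⊛ a ^ n) ⊛ (f (suc n) ⊛ ∏₁ n f)       ∎

  ∏ : List ZΔ → ZΔ
  ∏ = foldr _⊛_ oneZΔ

  ∏-++ : ∀ xs ys → ∏ (xs ++ ys) ≈ ∏ xs ⊛ ∏ ys
  ∏-++ [] ys = solve 1 (λ y → y := con (+ 1) :* y) ≈-refl (∏ ys)
  ∏-++ (x ∷ xs) ys = begin
    x ⊛ ∏ (xs ++ ys)     ≈⟨ ⊛-cong ≈-refl (∏-++ xs ys) ⟩
    x ⊛ (∏ xs ⊛ ∏ ys)    ≈⟨ solve 3 (λ x a b → x :* (a :* b) := (x :* a) :* b) ≈-refl x (∏ xs) (∏ ys) ⟩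
    (x ⊛ ∏ xs) ⊛ ∏ ys    ∎

  ∏-concatMap : ∀ {A : Set} (F : A → List ZΔ) xs → ∏ (concatMap F xs) ≈ ∏ (map (λ x → ∏ (F x)) xs)
  ∏-concatMap F [] = ≈-refl
  ∏-concatMap F (x ∷ xs) = ≈-trans (∏-++ (F x) (concatMap F xs)) (⊛-cong ≈-refl (∏-concatMap F xs))

  ∏-upTo : ∀ f n → ∏ (map f (applyUpTo suc n)) ≈ ∏₁ n f
  ∏-upTo f zero = ≈-refl
  ∏-upTo f (suc n) = begin
    ∏ (map f (applyUpTo suc (suc n)))
      ≈⟨ ≈-reflexive (cong (λ xs → ∏ (map f xs)) (sym (LP.applyUpTo-∷ʳ suc n))) ⟩
    ∏ (map f (applyUpTo suc n ++ [ suc n ]))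
      ≈⟨ ≈-reflexive (cong ∏ (LP.map-++ f (applyUpTo suc n) [ suc n ])) ⟩
    ∏ (map f (applyUpTo suc n) ++ [ f (suc n) ])
      ≈⟨ ∏-++ (map f (applyUpTo suc n)) [ f (suc n) ] ⟩
    ∏ (map f (applyUpTo suc n)) ⊛ (f (suc n) ⊛ oneZΔ)
      ≈⟨ ⊛-cong (∏-upTo f n) (solve 1 (λ a → a :* con (+ 1) := a) ≈-refl (f (suc n))) ⟩
    ∏₁ n f ⊛ f (suc n)
      ≈⟨ solve 2 (λ F a → F :* a := a :* F) ≈-refl (∏₁ n f) (f (suc n)) ⟩
    ∏₁ (suc n) f ∎

  prodZΔ-≡ : ∀ xs → prodZΔ Δ xs ≡ ∏ xs
  prodZΔ-≡ [] = refl
  prodZΔ-≡ (x ∷ xs) = trans (sym (⊛-unfold x (prodZΔ Δ xs))) (cong (x ⊛_) (prodZΔ-≡ xs))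

  powZΔ-≡ : ∀ x n → powZΔ Δ x n ≡ x ^ n
  powZΔ-≡ x zero = refl
  powZΔ-≡ x (suc n) = trans (sym (⊛-unfold x (powZΔ Δ x n))) (cong (x ⊛_) (powZΔ-≡ x n))

  pairFactor : (ℕ → ZΔ) → ℕ × ℕ → ZΔ
  pairFactor inv (s , t) = mulZΔ Δ (inv t) (inv s)

  row : ℕ → List (ℕ × ℕ)
  row t = map (λ s → (s , t)) (applyUpTo suc (ℕ.pred t))

  rowProduct : (ℕ → ZΔ) → ℕ → ZΔ
  rowProduct inv t = ∏ (map (pairFactor inv) (row t))

  row-value : ∀ inv k → rowProduct inv (suc k) ≈ inv (suc k) ^ k ⊛ ∏₁ k inv
  row-value inv k = begin
    rowProduct inv (suc k)
      ≈⟨ ≈-reflexive (cong ∏ (trans (sym (LP.map-∘ (applyUpTo suc k)))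
           (LP.map-cong (λ s → sym (⊛-unfold (inv (suc k)) (inv s))) (applyUpTo suc k)))) ⟩
    ∏ (map (λ s → inv (suc k) ⊛ inv s) (applyUpTo suc k))
      ≈⟨ ∏-upTo _ k ⟩
    ∏₁ k (λ s → inv (suc k) ⊛ inv s)
      ≈⟨ ∏₁-scale k (inv (suc k)) inv ⟩
    inv (suc k) ^ k ⊛ ∏₁ k inv ∎

  rows-value : ∀ inv n → ∏₁ n (rowProduct inv) ≈ ∏₁ n inv ^ (n ∸ 1)
  rows-value inv zero = ≈-refl
  rows-value inv (suc zero) = solve 0 (con (+ 1) :* con (+ 1) := con (+ 1)) ≈-refl
  rows-value inv (suc (suc j)) = begin
    rowProduct inv (suc (suc j)) ⊛ ∏₁ (suc j) (rowProduct inv)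
      ≈⟨ ⊛-cong (row-value inv (suc j)) (rows-value inv (suc j)) ⟩
    (b ^ suc j ⊛ J) ⊛ J ^ j
      ≈⟨ solve 3 (λ B J Jj → (B :* J) :* Jj := B :* (J :* Jj)) ≈-refl (b ^ suc j) J (J ^ j) ⟩
    b ^ suc j ⊛ J ^ suc j
      ≈⟨ ^-distrib-* b J (suc j) ⟨
    (b ⊛ J) ^ suc j ∎
    where
    b J : ZΔ
    b = inv (suc (suc j))
    J = ∏₁ (suc j) inv

  Cp-as-power : ∀ inv n → Cp Δ (suc n) inv ≈ ∏₁ n inv ^ (n ∸ 1)
  Cp-as-power inv n = begin
    Cp Δ (suc n) inv
      ≈⟨ ≈-reflexive (trans (prodZΔ-≡ (map (pairFactor inv) (concatMap row (applyUpTo suc n))))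
                            (cong ∏ (LP.map-concatMap (pairFactor inv) row (applyUpTo suc n)))) ⟩
    ∏ (concatMap (λ t → map (pairFactor inv) (row t)) (applyUpTo suc n))
      ≈⟨ ∏-concatMap (λ t → map (pairFactor inv) (row t)) (applyUpTo suc n) ⟩
    ∏ (map (rowProduct inv) (applyUpTo suc n))
      ≈⟨ ∏-upTo (rowProduct inv) n ⟩
    ∏₁ n (rowProduct inv)
      ≈⟨ rows-value inv n ⟩
    ∏₁ n inv ^ (n ∸ 1) ∎

module PrimeModulus (m : ℕ) (Δ : ℤ) (isPrime : Prime (suc m)) where

  p : ℕ
  p = suc m

  open QuotientRing p Δ
  open Polynomials p Δ
  open import Relation.Binary.Reasoning.Setoid setoid

  euclid : ∀ a b → p∣ a ℤ.* b → p∣ a ⊎ p∣ b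
  euclid a b p∣ab with euclidsLemma ∣ a ∣ ∣ b ∣ isPrime (subst (p ℕD.∣_) (ℤP.abs-* a b) (∣⇒∣ᵤ p∣ab))
  ... | inj₁ p∣a = inj₁ (∣ᵤ⇒∣ p∣a)
  ... | inj₂ p∣b = inj₂ (∣ᵤ⇒∣ p∣b)

  ∤-small : ∀ n → 0 < n → n < p → ¬ (p∣ + n)
  ∤-small n@(suc _) _ n<p p∣n = ℕP.<⇒≱ n<p (ℕD.∣⇒≤ (∣⇒∣ᵤ p∣n))

  ∤-difference : ∀ a b → a < b → b < p → ¬ (p∣ + b ℤ.- + a)
  ∤-difference a b a<b b<p p∣b-a = ∤-small (b ∸ a) (ℕP.m<n⇒0<n∸m a<b)
    (ℕP.≤-<-trans (ℕP.m∸n≤m b a) b<p)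
    (subst p∣_ (trans (ℤP.m-n≡m⊖n b a) (ℤP.⊖-≥ (ℕP.<⇒≤ a<b))) p∣b-a)

  embed-≈ : ∀ {a b} → p∣ a ℤ.- b → embed a ≈ embed b
  embed-≈ d = modp d , ≡ₚ-reflexive refl

  embed-≈0 : ∀ {a} → p∣ a → embed a ≈ zeroZΔ
  embed-≈0 {a} d = embed-≈ (subst p∣_ (sym (ℤP.+-identityʳ a)) d)

  ≈0⇒∣ : ∀ {a} → embed a ≈ zeroZΔ → p∣ a
  ≈0⇒∣ {a} (modp d , _) = subst p∣_ (ℤP.+-identityʳ a) d

  2≤p : 2 ≤ p
  2≤p = ℕ.nonTrivial⇒n>1 p {{prime⇒nonTrivial isPrime}}

  one≉zero : ¬ (oneZΔ ≈ zeroZΔ)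
  one≉zero 1≈0 = ∤-small 1 (ℕ.s≤s ℕ.z≤n) 2≤p (≈0⇒∣ 1≈0)

  -- integers prime to p are regular, by Euclid's lemma in each coordinate
  embed-regular : ∀ {a} → ¬ (p∣ a) → Regular (embed a)
  embed-regular {a} p∤a y ay≈0 with subst (_≈ zeroZΔ) (⊛-unfold (embed a) y) ay≈0
  ... | (modp d₁ , modp d₂) =
    cancel (subst p∣_ (re Δ a (proj₁ y) (proj₂ y)) d₁) ,
    cancel (subst p∣_ (im a (proj₁ y) (proj₂ y)) d₂)
    where
    re : ∀ D a y₁ y₂ → (a ℤ.* y₁ ℤ.+ D ℤ.* + 0 ℤ.* y₂) ℤ.- + 0 ≡ a ℤ.* y₁
    re = solve-∀
    im : ∀ a y₁ y₂ → (a ℤ.* y₂ ℤ.+ + 0 ℤ.* y₁) ℤ.- + 0 ≡ a ℤ.* y₂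
    im = solve-∀
    cancel : ∀ {u} → p∣ a ℤ.* u → u ≡ₚ + 0
    cancel {u} p∣au with euclid a u p∣au
    ... | inj₁ p∣a = ⊥-elim (p∤a p∣a)
    ... | inj₂ p∣u = modp (subst p∣_ (sym (ℤP.+-identityʳ u)) p∣u)

  embed-apart : ∀ {a b} → ¬ (p∣ b ℤ.- a) → Apart (embed a) (embed b)
  embed-apart {a} {b} p∤b-a =
    Regular-resp (≈-reflexive (sym (trans (cong (embed b ⊕_) (embed-neg a)) (embed-+ b (ℤ.- a)))))
      (embed-regular p∤b-a)

  ∤-factorial : ∀ k → k < p → ¬ (p ℕD.∣ k !)
  ∤-factorial zero _ p∣1 = ℕP.<⇒≱ 2≤p (ℕD.∣⇒≤ p∣1)
  ∤-factorial (suc k) k<p p∣k! with euclidsLemma (suc k) (k !) isPrime p∣k!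
  ... | inj₁ p∣k = ℕP.<⇒≱ k<p (ℕD.∣⇒≤ p∣k)
  ... | inj₂ p∣k! = ∤-factorial k (ℕP.<-trans (ℕP.n<1+n k) k<p) p∣k!

  -- p divides the binomial coefficients p C k, 0 < k < p:
  -- (p C k) · k! (p - k)! = p! and p divides neither k! nor (p - k)!
  ∣-binomial : ∀ k → 0 < k → k < p → p ℕD.∣ (p C k)
  ∣-binomial k 0<k k<p with euclidsLemma (p C k) (k ! ℕ.* (p ∸ k) !) isPrime p∣product
    where
    product : (p C k) ℕ.* (k ! ℕ.* (p ∸ k) !) ≡ p !
    product = trans (cong (ℕ._* (k ! ℕ.* (p ∸ k) !)) (nCk≡n!/k![n-k]! (ℕP.<⇒≤ k<p)))
                    (m/n*n≡m {{ℕP._!*_!≢0 k (p ∸ k)}} (k![n∸k]!∣n! (ℕP.<⇒≤ k<p)))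
    p∣product : p ℕD.∣ (p C k) ℕ.* (k ! ℕ.* (p ∸ k) !)
    p∣product = subst (p ℕD.∣_) (sym product) (ℕD.m∣m*n (m !))
  ... | inj₁ p∣C = p∣C
  ... | inj₂ p∣k!* with euclidsLemma (k !) ((p ∸ k) !) isPrime p∣k!*
  ... | inj₁ p∣k! = ⊥-elim (∤-factorial k k<p p∣k!)
  ... | inj₂ p∣[p-k]! = ⊥-elim (∤-factorial (p ∸ k) (ℕP.∸-monoʳ-< 0<k (ℕP.<⇒≤ k<p)) p∣[p-k]!)

  open import Algebra.Properties.CommutativeSemiring.Binomial commutativeSemiring
    using (theorem; binomialTerm)
  open import Algebra.Properties.Semiring.Sum semiring
    using (sum; sum-init-last; sum-cong-≋; sum-replicate-zero)
  open import Algebra.Properties.Semiring.Mult semiring using () renaming (_×_ to _·_)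

  ·-embed : ∀ n z → n · z ≈ embed (+ n) ⊛ z
  ·-embed zero z = solve 1 (λ z → con (+ 0) := con (+ 0) :* z) ≈-refl z
  ·-embed (suc n) z = begin
    z ⊕ n · z                    ≈⟨ ⊕-cong ≈-refl (·-embed n z) ⟩
    z ⊕ embed (+ n) ⊛ z          ≈⟨ solve 2 (λ z e → z :+ e :* z := (con (+ 1) :+ e) :* z) ≈-refl z (embed (+ n)) ⟩
    (oneZΔ ⊕ embed (+ n)) ⊛ z    ≈⟨ ⊛-cong (≈-reflexive (embed-+ (+ 1) (+ n))) ≈-refl ⟩
    embed (+ suc n) ⊛ z          ∎

  multiple-of-p≈0 : ∀ n z → p ℕD.∣ n → n · z ≈ zeroZΔ
  multiple-of-p≈0 n z (ℕD.divides q refl) = begin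
    n · z                   ≈⟨ ·-embed n z ⟩
    embed (+ n) ⊛ z         ≈⟨ ⊛-cong (embed-≈0 (divides (+ q) (ℤP.pos-* q p))) ≈-refl ⟩
    zeroZΔ ⊛ z              ≈⟨ solve 1 (λ z → con (+ 0) :* z := con (+ 0)) ≈-refl z ⟩
    zeroZΔ                  ∎

  -- Frobenius: (x + y)^p = x^p + y^p, as all middle binomial terms vanish
  frobenius : ∀ x y → (x ⊕ y) ^ p ≈ x ^ p ⊕ y ^ p
  frobenius x y = begin
    (x ⊕ y) ^ p
      ≈⟨ theorem p x y ⟩
    term Fin.zero ⊕ sum (λ i → term (Fin.suc i))
      ≈⟨ ⊕-cong ≈-refl (sum-init-last (λ i → term (Fin.suc i))) ⟩
    term Fin.zero ⊕ (sum (λ j → term (Fin.suc (inject₁ j))) ⊕ term (Fin.suc (fromℕ m)))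
      ≈⟨ ⊕-cong first (⊕-cong middle (last (toℕ (fromℕ m)) (FinP.toℕ-fromℕ m))) ⟩
    y ^ p ⊕ (zeroZΔ ⊕ x ^ p)
      ≈⟨ solve 2 (λ a b → b :+ (con (+ 0) :+ a) := a :+ b) ≈-refl (x ^ p) (y ^ p) ⟩
    x ^ p ⊕ y ^ p ∎
    where
    term : Fin (suc p) → ZΔ
    term = binomialTerm x y p
    first : term Fin.zero ≈ y ^ p
    first = solve 1 (λ w → (con (+ 1) :* w) :+ con (+ 0) := w) ≈-refl (y ^ p)
    middle : sum (λ j → term (Fin.suc (inject₁ j))) ≈ zeroZΔ
    middle = ≈-trans (sum-cong-≋ (λ j → multiple-of-p≈0 _ _ (∣-binomial (suc (toℕ (inject₁ j))) (ℕ.s≤s ℕ.z≤n)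
                       (ℕ.s≤s (subst (_< m) (sym (FinP.toℕ-inject₁ j)) (FinP.toℕ<n j))))))
                     (sum-replicate-zero m)
    last : ∀ k → k ≡ m → (p C suc k) · (x ^ suc k ⊛ y ^ (m ∸ k)) ≈ x ^ p
    last k refl rewrite nCn≡1 p | ℕP.n∸n≡0 m =
      solve 1 (λ w → (w :* con (+ 1)) :+ con (+ 0) := w) ≈-refl (x ^ p)

  zero^p : zeroZΔ ^ p ≈ zeroZΔ
  zero^p = solve 1 (λ w → con (+ 0) :* w := con (+ 0)) ≈-refl (zeroZΔ ^ m)

  -- Fermat's little theorem: a^p = a for every integer a, first for
  -- naturals by induction using additivity, then for negatives using u + v = 0
  fermat-ℕ : ∀ n → embed (+ n) ^ p ≈ embed (+ n)
  fermat-ℕ zero = zero^p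
  fermat-ℕ (suc n) = begin
    embed (+ suc n) ^ p             ≈⟨ ^-congˡ p (≈-reflexive (sym (embed-+ (+ 1) (+ n)))) ⟩
    (oneZΔ ⊕ embed (+ n)) ^ p       ≈⟨ frobenius oneZΔ (embed (+ n)) ⟩
    oneZΔ ^ p ⊕ embed (+ n) ^ p     ≈⟨ ⊕-cong (one^ p) (fermat-ℕ n) ⟩
    oneZΔ ⊕ embed (+ n)             ≈⟨ ≈-reflexive (embed-+ (+ 1) (+ n)) ⟩
    embed (+ suc n)                 ∎

  fermat : ∀ a → embed a ^ p ≈ embed a
  fermat (+ n) = fermat-ℕ n
  fermat -[1+ n ] = begin
    u ^ p                            ≈⟨ solve 2 (λ a b → a := (a :+ b) :- b) ≈-refl (u ^ p) (v ^ p) ⟩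
    (u ^ p ⊕ v ^ p) ⊕ ⊖ v ^ p        ≈⟨ ⊕-cong (≈-sym (frobenius u v)) (⊖-cong (fermat-ℕ (suc n))) ⟩
    (u ⊕ v) ^ p ⊕ ⊖ v                ≈⟨ ⊕-cong (≈-trans (^-congˡ p u+v≈0) zero^p) ≈-refl ⟩
    zeroZΔ ⊕ ⊖ v                     ≈⟨ ⊕-cong u+v≈0 ≈-refl ⟨
    (u ⊕ v) ⊕ ⊖ v                    ≈⟨ solve 2 (λ a b → (a :+ b) :- b := a) ≈-refl u v ⟩
    u                                ∎
    where
    u v : ZΔ
    u = embed -[1+ n ]
    v = embed (+ suc n)
    u+v≈0 : u ⊕ v ≈ zeroZΔ
    u+v≈0 = ≈-reflexive (trans (embed-+ -[1+ n ] (+ suc n)) (cong embed (ℤP.+-inverseˡ (+ suc n))))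

  fermat-unit : ∀ {a} → ¬ (p∣ a) → embed a ^ m ≈ oneZΔ
  fermat-unit {a} p∤a = difference≈0 (embed-regular p∤a _ (begin
    e ⊛ (e ^ m ⊕ ⊖ oneZΔ)    ≈⟨ solve 2 (λ e w → e :* (w :- con (+ 1)) := e :* w :- e) ≈-refl e (e ^ m) ⟩
    e ^ p ⊕ ⊖ e              ≈⟨ ⊕-cong (fermat a) ≈-refl ⟩
    e ⊕ ⊖ e                  ≈⟨ solve 1 (λ e → e :- e := con (+ 0)) ≈-refl e ⟩
    zeroZΔ                   ∎))
    where
    e : ZΔ
    e = embed a

  -- the integer square roots of 1 are ±1: p ∣ (y - 1)(y + 1)
  square-root-of-one : ∀ y → embed y ⊛ embed y ≈ oneZΔ → embed y ≈ oneZΔ ⊎ embed y ≈ ⊖ oneZΔ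
  square-root-of-one y yy≈1 with subst (_≈ oneZΔ) (embed-* y y) yy≈1
  ... | (modp p∣y²-1 , _) with euclid (y ℤ.- + 1) (y ℤ.+ + 1) (subst p∣_ (factor y) p∣y²-1)
    where
    factor : ∀ y → y ℤ.* y ℤ.- + 1 ≡ (y ℤ.- + 1) ℤ.* (y ℤ.+ + 1)
    factor = solve-∀
  ... | inj₁ p∣y-1 = inj₁ (embed-≈ p∣y-1)
  ... | inj₂ p∣y+1 = inj₂ (≈-trans (embed-≈ p∣y+1) (≈-reflexive (sym (embed-neg (+ 1)))))

-- ∏_{t=0}^{p-1} (x + t) = x^p - x for every x: the lower coefficients of
-- the monic polynomial ∏ (X + t), plus X, vanish at the p residues
-- 0, …, p - 1 (Fermat), so by root counting they are zero.
module LinearFactors (m : ℕ) (Δ : ℤ) (isPrime : Prime (suc m)) where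

  open PrimeModulus m Δ isPrime
  open QuotientRing p Δ
  open Polynomials p Δ
  open import Relation.Binary.Reasoning.Setoid setoid

  linearProduct : ℕ → ZΔ → ZΔ
  linearProduct zero x = oneZΔ
  linearProduct (suc n) x = (x ⊕ embed (+ n)) ⊛ linearProduct n x

  linearProduct-root : ∀ n x t → t < n → x ⊕ embed (+ t) ≈ zeroZΔ → linearProduct n x ≈ zeroZΔ
  linearProduct-root (suc n) x t t<n x+t≈0 with t ℕ.≟ n
  ... | yes refl = ≈-trans (⊛-cong x+t≈0 ≈-refl)
                     (solve 1 (λ y → con (+ 0) :* y := con (+ 0)) ≈-refl (linearProduct n x))
  ... | no t≢n = ≈-trans (⊛-cong ≈-refl (linearProduct-root n x t (ℕP.≤∧≢⇒< (ℕP.≤-pred t<n) t≢n) x+t≈0))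
                   (solve 1 (λ y → y :* con (+ 0) := con (+ 0)) ≈-refl (x ⊕ embed (+ n)))

  -- every residue r < p is a root: r + (p - r) = p (or r = 0)
  linearProduct-residue : ∀ r → r < p → linearProduct p (embed (+ r)) ≈ zeroZΔ
  linearProduct-residue zero _ = linearProduct-root p _ 0 (ℕ.s≤s ℕ.z≤n) (≈-reflexive (embed-+ (+ 0) (+ 0)))
  linearProduct-residue r@(suc _) r<p =
    linearProduct-root p _ (p ∸ r) (ℕP.∸-monoʳ-< (ℕ.s≤s ℕ.z≤n) (ℕP.<⇒≤ r<p))
      (≈-trans (≈-reflexive (trans (embed-+ (+ r) (+ (p ∸ r)))
                  (cong (λ n → embed (+ n)) (ℕP.m+[n∸m]≡n (ℕP.<⇒≤ r<p)))))
               (embed-≈0 (divides (+ 1) (sym (ℤP.*-identityˡ (+ p))))))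

  -- lower coefficients of (X + c)(X^n + g), for g with n coefficients
  linearLower : ZΔ → List ZΔ → List ZΔ
  linearLower c [] = c ∷ []
  linearLower c (a ∷ g) = (c ⊛ a) ∷ addConst a (linearLower c g)

  linearLower-length : ∀ c g → length (linearLower c g) ≡ suc (length g)
  linearLower-length c [] = refl
  linearLower-length c (a ∷ g) = cong suc (trans (addConst-length a (linearLower c g))
                                                  (cong (λ n → suc (ℕ.pred n)) (linearLower-length c g)))

  linearLower-eval : ∀ c g x → eval (linearLower c g) x ≈ c ⊛ x ^ length g ⊕ (x ⊕ c) ⊛ eval g x
  linearLower-eval c [] x =
    solve 2 (λ c x → c :+ x :* con (+ 0) := c :* con (+ 1) :+ (x :+ c) :* con (+ 0)) ≈-refl c x
  linearLower-eval c (a ∷ g) x = begin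
    c ⊛ a ⊕ x ⊛ eval (addConst a (linearLower c g)) x
      ≈⟨ ⊕-cong ≈-refl (⊛-cong ≈-refl (≈-trans (addConst-eval a (linearLower c g) x)
                                                (⊕-cong ≈-refl (linearLower-eval c g x)))) ⟩
    c ⊛ a ⊕ x ⊛ (a ⊕ (c ⊛ X ⊕ (x ⊕ c) ⊛ G))
      ≈⟨ solve 5 (λ c a x X G → c :* a :+ x :* (a :+ (c :* X :+ (x :+ c) :* G))
                              := c :* (x :* X) :+ (x :+ c) :* (a :+ x :* G)) ≈-refl c a x X G ⟩
    c ⊛ (x ⊛ X) ⊕ (x ⊕ c) ⊛ (a ⊕ x ⊛ G) ∎
    where
    X G : ZΔ
    X = x ^ length g
    G = eval g x

  lowerCoefficients : ℕ → List ZΔ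
  lowerCoefficients zero = []
  lowerCoefficients (suc n) = linearLower (embed (+ n)) (lowerCoefficients n)

  lowerCoefficients-length : ∀ n → length (lowerCoefficients n) ≡ n
  lowerCoefficients-length zero = refl
  lowerCoefficients-length (suc n) =
    trans (linearLower-length _ (lowerCoefficients n)) (cong suc (lowerCoefficients-length n))

  linearProduct-monic : ∀ n x → linearProduct n x ≈ x ^ n ⊕ eval (lowerCoefficients n) x
  linearProduct-monic zero x = solve 1 (λ x → con (+ 1) := con (+ 1) :+ con (+ 0)) ≈-refl x
  linearProduct-monic (suc n) x = begin
    (x ⊕ c) ⊛ linearProduct n x
      ≈⟨ ⊛-cong ≈-refl (linearProduct-monic n x) ⟩
    (x ⊕ c) ⊛ (x ^ n ⊕ G)
      ≈⟨ solve 4 (λ x c X G → (x :+ c) :* (X :+ G) := x :* X :+ (c :* X :+ (x :+ c) :* G))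
                 ≈-refl x c (x ^ n) G ⟩
    x ⊛ x ^ n ⊕ (c ⊛ x ^ n ⊕ (x ⊕ c) ⊛ G)
      ≈⟨ ⊕-cong ≈-refl (⊕-cong (⊛-cong ≈-refl (≈-reflexive (cong (x ^_) (sym (lowerCoefficients-length n)))))
                                ≈-refl) ⟩
    x ⊛ x ^ n ⊕ (c ⊛ x ^ length (lowerCoefficients n) ⊕ (x ⊕ c) ⊛ G)
      ≈⟨ ⊕-cong ≈-refl (linearLower-eval c (lowerCoefficients n) x) ⟨
    x ^ suc n ⊕ eval (lowerCoefficients (suc n)) x ∎
    where
    c G : ZΔ
    c = embed (+ n)
    G = eval (lowerCoefficients n) x

  plusX : List ZΔ → List ZΔ
  plusX [] = zeroZΔ ∷ oneZΔ ∷ []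
  plusX (a ∷ f) = a ∷ addConst oneZΔ f

  plusX-eval : ∀ f x → eval (plusX f) x ≈ eval f x ⊕ x
  plusX-eval [] x =
    solve 1 (λ x → con (+ 0) :+ x :* (con (+ 1) :+ x :* con (+ 0)) := con (+ 0) :+ x) ≈-refl x
  plusX-eval (a ∷ f) x = begin
    a ⊕ x ⊛ eval (addConst oneZΔ f) x   ≈⟨ ⊕-cong ≈-refl (⊛-cong ≈-refl (addConst-eval oneZΔ f x)) ⟩
    a ⊕ x ⊛ (oneZΔ ⊕ eval f x)          ≈⟨ solve 3 (λ a x w → a :+ x :* (con (+ 1) :+ w) := (a :+ x :* w) :+ x)
                                                 ≈-refl a x (eval f x) ⟩
    (a ⊕ x ⊛ eval f x) ⊕ x              ∎

  plusX-length : ∀ f n → length f ≤ n → 2 ≤ n → length (plusX f) ≤ n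
  plusX-length [] n _ 2≤n = 2≤n
  plusX-length (a ∷ []) (suc n) _ (ℕ.s≤s 1≤n) = ℕ.s≤s 1≤n
  plusX-length (a ∷ b ∷ f) (suc n) (ℕ.s≤s len≤n) _ = ℕ.s≤s len≤n

  residues : List ZΔ
  residues = applyUpTo (λ r → embed (+ r)) p

  residues-apart : AllPairs Apart residues
  residues-apart = AllPairsP.applyUpTo⁺₁ (λ r → embed (+ r)) p
    (λ {r} {s} r<s s<p → embed-apart {+ r} {+ s} (∤-difference r s r<s s<p))

  -- ∏_{t<p} (X + t) - X^p + X has fewer than p coefficients and vanishes at
  -- every residue r (the product vanishes and r^p = r), so it is zero
  X^p-X-coefficients : IsZero (plusX (lowerCoefficients p))
  X^p-X-coefficients = root-counting residues (plusX L) length≤ residues-apart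
    (AllP.applyUpTo⁺₁ (λ r → embed (+ r)) p (λ {r} r<p → root r r<p))
    where
    L : List ZΔ
    L = lowerCoefficients p
    length≤ : length (plusX L) ≤ length residues
    length≤ = subst (length (plusX L) ≤_) (sym (LP.length-applyUpTo (λ r → embed (+ r)) p))
      (plusX-length L p (ℕP.≤-reflexive (lowerCoefficients-length p)) 2≤p)
    root : ∀ r → r < p → eval (plusX L) (embed (+ r)) ≈ zeroZΔ
    root r r<p = begin
      eval (plusX L) e                   ≈⟨ plusX-eval L e ⟩
      eval L e ⊕ e                       ≈⟨ solve 3 (λ G e E → G :+ e := (E :+ G) :+ (e :- E)) ≈-refl (eval L e) e (e ^ p) ⟩
      (e ^ p ⊕ eval L e) ⊕ (e ⊕ ⊖ e ^ p) ≈⟨ ⊕-cong (≈-trans (≈-sym (linearProduct-monic p e)) (linearProduct-residue r r<p))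
                                                   (≈⇒difference≈0 (≈-sym (fermat (+ r)))) ⟩
      zeroZΔ ⊕ zeroZΔ                    ≈⟨ solve 0 (con (+ 0) :+ con (+ 0) := con (+ 0)) ≈-refl ⟩
      zeroZΔ                             ∎
      where
      e : ZΔ
      e = embed (+ r)

  linearProduct-full : ∀ x → linearProduct p x ≈ x ^ p ⊕ ⊖ x
  linearProduct-full x = begin
    linearProduct p x                      ≈⟨ linearProduct-monic p x ⟩
    x ^ p ⊕ G                              ≈⟨ solve 3 (λ X G x → X :+ G := X :+ ((G :+ x) :- x)) ≈-refl (x ^ p) G x ⟩
    x ^ p ⊕ ((G ⊕ x) ⊕ ⊖ x)               ≈⟨ ⊕-cong ≈-refl (⊕-cong (≈-trans (≈-sym (plusX-eval L x))
                                                 (eval-zero (plusX L) x X^p-X-coefficients)) ≈-refl) ⟩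
    x ^ p ⊕ (zeroZΔ ⊕ ⊖ x)                ≈⟨ solve 2 (λ X x → X :+ (con (+ 0) :- x) := X :- x) ≈-refl (x ^ p) x ⟩
    x ^ p ⊕ ⊖ x                            ∎
    where
    L : List ZΔ
    L = lowerCoefficients p
    G : ZΔ
    G = eval L x

module LegendreSymbol (p : ℕ) where

  open IntegersModulo p

  data LegendreView (a : ℤ) : ℤ → Set where
    divisible  : p∣ a → LegendreView a (+ 0)
    residue    : ∀ x → p∣ + x ℤ.* + x ℤ.- a → LegendreView a (+ 1)
    nonresidue : ¬ (p∣ a) → NonSquare a → LegendreView a -[1+ 0 ]

  isSquareRoot : ℤ → ℕ → Bool
  isSquareRoot a x = ⌊ p ℕD.∣? ∣ (+ x) ℤ.* (+ x) ℤ.- a ∣ ⌋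

  legendreView : ∀ a → LegendreView a (legendre a p)
  legendreView a with p ℕD.∣? ∣ a ∣
  ... | yes p∣a = divisible (∣ᵤ⇒∣ p∣a)
  ... | no p∤a with any (isSquareRoot a) (upTo p) in search
  ...   | true with find (any⁻ (isSquareRoot a) (upTo p) (subst T (sym search) _))
  ...     | x , _ , x²≡a = residue x (∣ᵤ⇒∣ (toWitness x²≡a))
  legendreView a | no p∤a | false =
    nonresidue (λ p∣a → p∤a (∣⇒∣ᵤ p∣a))
      (λ x x<p p∣x²-a → subst T search (any⁺ (isSquareRoot a) (lose (∈-upTo⁺ x<p) (fromWitness (∣⇒∣ᵤ p∣x²-a)))))

  legendre≡-1 : ∀ {a} → legendre a p ≡ -[1+ 0 ] → ¬ (p∣ a) × NonSquare a
  legendre≡-1 {a} = from-view (legendreView a)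
    where
    from-view : ∀ {ℓ} → LegendreView a ℓ → ℓ ≡ -[1+ 0 ] → ¬ (p∣ a) × NonSquare a
    from-view (divisible _) ()
    from-view (residue _ _) ()
    from-view (nonresidue p∤a nonsquare) _ = p∤a , nonsquare

half-positive : ∀ h → 2 ≤ suc (h ℕ.+ h) → 1 ≤ h
half-positive zero (ℕ.s≤s ())
half-positive (suc h) _ = ℕ.s≤s ℕ.z≤n

odd-exponent : ∀ h → 1 ≤ h → (h ℕ.+ h) ∸ 1 ≡ suc (ℕ.pred h ℕ.+ ℕ.pred h)
odd-exponent (suc j) _ = ℕP.+-suc j j

module OddPrime (h : ℕ) (Δ : ℤ) (isPrime : Prime (suc (h ℕ.+ h))) where

  open PrimeModulus (h ℕ.+ h) Δ isPrime
  open QuotientRing p Δ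
  open Polynomials p Δ
  open Products p Δ
  open LinearFactors (h ℕ.+ h) Δ isPrime
  open LegendreSymbol p
  open import Relation.Binary.Reasoning.Setoid setoid

  1≤h : 1 ≤ h
  1≤h = half-positive h 2≤p

  h<p : h < p
  h<p = ℕ.s≤s (ℕP.m≤m+n h h)

  -- nonzero squares satisfy a^h = 1, since (x²)^h = x^(p-1)
  square-power : ∀ {a} → ¬ (p∣ a) → embed (a ℤ.* a) ^ h ≈ oneZΔ
  square-power {a} p∤a = begin
    embed (a ℤ.* a) ^ h          ≈⟨ ^-congˡ h (≈-reflexive (sym (embed-* a a))) ⟩
    (embed a ⊛ embed a) ^ h      ≈⟨ ^-double (embed a) h ⟩
    embed a ^ (h ℕ.+ h)          ≈⟨ fermat-unit p∤a ⟩
    oneZΔ                        ∎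

  -- the squares 1², …, h² are pairwise apart: (j+1)² - (i+1)² = (j - i)(i + j + 2)
  squares : List ZΔ
  squares = applyUpTo (λ t → embed (+ suc t ℤ.* + suc t)) h

  squares-apart : AllPairs Apart squares
  squares-apart = AllPairsP.applyUpTo⁺₁ _ h (λ {i} {j} i<j j<h →
    embed-apart (λ p∣j²-i² → [ ∤-difference (suc i) (suc j) (ℕ.s≤s i<j) (ℕP.≤-<-trans j<h h<p)
                           , ∤-small (suc j ℕ.+ suc i) (ℕ.s≤s ℕ.z≤n)
                               (ℕ.s≤s (ℕP.+-mono-≤ j<h (ℕP.<-trans i<j j<h)))
                           ]′ (euclid _ _ (subst p∣_ (factor (+ suc j) (+ suc i)) p∣j²-i²))))
    where
    factor : ∀ a b → a ℤ.* a ℤ.- b ℤ.* b ≡ (a ℤ.- b) ℤ.* (a ℤ.+ b)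
    factor = solve-∀

  -- A non-residue c is not a root of X^h - 1: otherwise X^h - 1 would have
  -- the h + 1 pairwise apart roots c, 1², …, h².
  nonresidue-power≉1 : ∀ {c} → NonSquare c → ¬ (embed c ^ h ≈ oneZΔ)
  nonresidue-power≉1 {c} nonsquare c^h≈1 = one≉zero (monomial+const-nonzero (⊖ oneZΔ) h 1≤h
    (root-counting (embed c ∷ squares) X^h-1 length≤ (c-apart ∷ squares-apart)
      (root (embed c) c^h≈1 ∷ square-roots)))
    where
    X^h-1 : List ZΔ
    X^h-1 = addConst (⊖ oneZΔ) (monomial h)
    length≤ : length X^h-1 ≤ suc (length squares)
    length≤ = ℕP.≤-reflexive (trans (addConst-length _ (monomial h))
                (cong (λ n → suc (ℕ.pred n)) (trans (monomial-length h) (cong suc (sym (LP.length-applyUpTo _ h))))))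
    c-apart : All (Apart (embed c)) squares
    c-apart = AllP.applyUpTo⁺₁ _ h (λ {t} t<h → embed-apart (nonsquare (suc t) (ℕP.≤-<-trans t<h h<p)))
    root : ∀ x → x ^ h ≈ oneZΔ → eval X^h-1 x ≈ zeroZΔ
    root x x^h≈1 = begin
      eval X^h-1 x                 ≈⟨ addConst-eval (⊖ oneZΔ) (monomial h) x ⟩
      ⊖ oneZΔ ⊕ eval (monomial h) x ≈⟨ ⊕-cong ≈-refl (≈-trans (monomial-eval h x) x^h≈1) ⟩
      ⊖ oneZΔ ⊕ oneZΔ              ≈⟨ solve 0 (:- con (+ 1) :+ con (+ 1) := con (+ 0)) ≈-refl ⟩
      zeroZΔ                       ∎
    square-roots : All (λ s → eval X^h-1 s ≈ zeroZΔ) squares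
    square-roots = AllP.applyUpTo⁺₁ _ h (λ {t} t<h →
      root _ (square-power (∤-small (suc t) (ℕ.s≤s ℕ.z≤n) (ℕP.≤-<-trans t<h h<p))))

  -- Euler's criterion for a non-residue: c^h = -1, as c^h squares to 1
  nonresidue-power : ∀ {c} → ¬ (p∣ c) → NonSquare c → embed c ^ h ≈ ⊖ oneZΔ
  nonresidue-power {c} p∤c nonsquare =
    [ (λ c^h≈1 → ⊥-elim (nonresidue-power≉1 nonsquare (≈-trans (embed-^ c h) c^h≈1)))
    , (λ c^h≈-1 → ≈-trans (embed-^ c h) c^h≈-1)
    ]′ (square-root-of-one (c ℤ.^ h) squares-to-one)
    where
    squares-to-one : embed (c ℤ.^ h) ⊛ embed (c ℤ.^ h) ≈ oneZΔ
    squares-to-one = begin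
      embed (c ℤ.^ h) ⊛ embed (c ℤ.^ h) ≈⟨ ⊛-cong (embed-^ c h) (embed-^ c h) ⟨
      embed c ^ h ⊛ embed c ^ h         ≈⟨ ^-homo-* (embed c) h h ⟨
      embed c ^ (h ℕ.+ h)               ≈⟨ fermat-unit p∤c ⟩
      oneZΔ                             ∎

  euler-criterion : ∀ a → ¬ (p∣ a) → embed a ^ h ≈ embed (legendre a p)
  euler-criterion a p∤a = by-cases (legendreView a)
    where
    by-cases : ∀ {ℓ} → LegendreView a ℓ → embed a ^ h ≈ embed ℓ
    by-cases (divisible p∣a) = ⊥-elim (p∤a p∣a)
    by-cases (residue x p∣x²-a) = begin
      embed a ^ h                  ≈⟨ ^-congˡ h (embed-≈ (subst p∣_ (negate (+ x ℤ.* + x) a) (∣m⇒∣-m p∣x²-a))) ⟩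
      embed (+ x ℤ.* + x) ^ h      ≈⟨ square-power p∤x ⟩
      oneZΔ                        ∎
      where
      negate : ∀ u a → ℤ.- (u ℤ.- a) ≡ a ℤ.- u
      negate = solve-∀
      p∤x : ¬ (p∣ + x)
      p∤x p∣x = p∤a (subst p∣_ (cancel (+ x ℤ.* + x) a) (∣m∣n⇒∣m-n (∣n⇒∣m*n (+ x) p∣x) p∣x²-a))
        where
        cancel : ∀ u a → u ℤ.- (u ℤ.- a) ≡ a
        cancel = solve-∀
    by-cases (nonresidue _ nonsquare) =
      ≈-trans (nonresidue-power p∤a nonsquare) (≈-reflexive (embed-neg (+ 1)))

  legendre-involution : ∀ a → ¬ (p∣ a) → embed (legendre a p) ⊛ embed (legendre a p) ≈ oneZΔ
  legendre-involution a p∤a = by-cases (legendreView a)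
    where
    by-cases : ∀ {ℓ} → LegendreView a ℓ → embed ℓ ⊛ embed ℓ ≈ oneZΔ
    by-cases (divisible p∣a) = ⊥-elim (p∤a p∣a)
    by-cases (residue _ _) = solve 0 (con (+ 1) :* con (+ 1) := con (+ 1)) ≈-refl
    by-cases (nonresidue _ _) = solve 0 (con -[1+ 0 ] :* con -[1+ 0 ] := con (+ 1)) ≈-refl

  -- √Δ is regular when p ∤ Δ, since √Δ · √Δ = Δ is
  √Δ-regular : ¬ (p∣ Δ) → Regular √Δ
  √Δ-regular p∤Δ y √Δy≈0 = embed-regular p∤Δ y (begin
    embed Δ ⊛ y          ≈⟨ ⊛-cong (≈-reflexive (sym √Δ-squared)) ≈-refl ⟩
    (√Δ ⊛ √Δ) ⊛ y        ≈⟨ solve 2 (λ a y → (a :* a) :* y := a :* (a :* y)) ≈-refl √Δ y ⟩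
    √Δ ⊛ (√Δ ⊛ y)        ≈⟨ ⊛-cong ≈-refl √Δy≈0 ⟩
    √Δ ⊛ zeroZΔ          ≈⟨ solve 1 (λ a → a :* con (+ 0) := con (+ 0)) ≈-refl √Δ ⟩
    zeroZΔ               ∎)

  -- Frobenius conjugates √Δ when Δ is a non-residue: √Δ^p = √Δ · Δ^h = -√Δ
  √Δ-frobenius : embed Δ ^ h ≈ ⊖ oneZΔ → √Δ ^ p ≈ ⊖ √Δ
  √Δ-frobenius Δ^h≈-1 = begin
    √Δ ⊛ √Δ ^ (h ℕ.+ h)     ≈⟨ ⊛-cong ≈-refl (^-double √Δ h) ⟨
    √Δ ⊛ (√Δ ⊛ √Δ) ^ h      ≈⟨ ⊛-cong ≈-refl (≈-trans (^-congˡ h (≈-reflexive √Δ-squared)) Δ^h≈-1) ⟩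
    √Δ ⊛ ⊖ oneZΔ            ≈⟨ solve 1 (λ a → a :* (:- con (+ 1)) := :- a) ≈-refl √Δ ⟩
    ⊖ √Δ                    ∎

  linearProduct-√Δ : ∀ n → linearProduct (suc n) √Δ ≈ ∏₁ n tPlusSqrtΔ ⊛ √Δ
  linearProduct-√Δ zero = begin
    (√Δ ⊕ embed (+ 0)) ⊛ oneZΔ   ≈⟨ ⊛-cong (≈-reflexive (tPlusSqrtΔ-≡ 0)) ≈-refl ⟩
    tPlusSqrtΔ 0 ⊛ oneZΔ          ≈⟨ solve 1 (λ a → a :* con (+ 1) := con (+ 1) :* a) ≈-refl (tPlusSqrtΔ 0) ⟩
    oneZΔ ⊛ tPlusSqrtΔ 0          ∎
  linearProduct-√Δ (suc n) = begin
    (√Δ ⊕ embed (+ suc n)) ⊛ linearProduct (suc n) √Δ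
      ≈⟨ ⊛-cong (≈-reflexive (tPlusSqrtΔ-≡ (suc n))) (linearProduct-√Δ n) ⟩
    tPlusSqrtΔ (suc n) ⊛ (∏₁ n tPlusSqrtΔ ⊛ √Δ)
      ≈⟨ solve 3 (λ t P a → t :* (P :* a) := (t :* P) :* a) ≈-refl (tPlusSqrtΔ (suc n)) (∏₁ n tPlusSqrtΔ) √Δ ⟩
    ∏₁ (suc n) tPlusSqrtΔ ⊛ √Δ ∎

  -- ∏_{t=1}^{p-1} (t + √Δ) = -2 for a non-residue Δ: multiplied by √Δ it is
  -- ∏_{t<p} (√Δ + t) = √Δ^p - √Δ = -2√Δ, and √Δ is regular
  product-t+√Δ : ¬ (p∣ Δ) → embed Δ ^ h ≈ ⊖ oneZΔ → ∏₁ (h ℕ.+ h) tPlusSqrtΔ ≈ embed -[1+ 1 ]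
  product-t+√Δ p∤Δ Δ^h≈-1 = difference≈0 (√Δ-regular p∤Δ _ (begin
    √Δ ⊛ (Π ⊕ ⊖ embed -[1+ 1 ])  ≈⟨ solve 2 (λ a P → a :* (P :- con -[1+ 1 ]) := P :* a :+ (a :+ a)) ≈-refl √Δ Π ⟩
    Π ⊛ √Δ ⊕ (√Δ ⊕ √Δ)           ≈⟨ ⊕-cong (≈-trans (≈-sym (linearProduct-√Δ (h ℕ.+ h))) (linearProduct-full √Δ)) ≈-refl ⟩
    (√Δ ^ p ⊕ ⊖ √Δ) ⊕ (√Δ ⊕ √Δ)  ≈⟨ ⊕-cong (⊕-cong (√Δ-frobenius Δ^h≈-1) ≈-refl) ≈-refl ⟩
    (⊖ √Δ ⊕ ⊖ √Δ) ⊕ (√Δ ⊕ √Δ)    ≈⟨ solve 1 (λ a → (:- a :- a) :+ (a :+ a) := con (+ 0)) ≈-refl √Δ ⟩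
    zeroZΔ                       ∎))
    where
    Π : ZΔ
    Π = ∏₁ (h ℕ.+ h) tPlusSqrtΔ

  -- The theorem in ring form.  With J = ∏ inv t, the hypothesis gives
  -- J · (-2) = 1, so J^h = ((-2)^h)⁻¹ = (-2 / p); and C_p = J^(p-2), an odd
  -- power, so C_p^h = (-2 / p)^(p-2) = (-2 / p).
  Cp-power : (inv : ℕ → ZΔ) → (∀ t → 1 ≤ t → t ≤ h ℕ.+ h → inv t ⊛ tPlusSqrtΔ t ≈ oneZΔ) →
    ¬ (p∣ Δ) → NonSquare Δ →
    Cp Δ p inv ^ h ≈ embed (legendre -[1+ 1 ] p)
  Cp-power inv inverse p∤Δ nonsquare = begin
    Cp Δ p inv ^ h                    ≈⟨ ^-congˡ h (Cp-as-power inv (h ℕ.+ h)) ⟩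
    (J ^ ((h ℕ.+ h) ∸ 1)) ^ h          ≈⟨ ^-swap J ((h ℕ.+ h) ∸ 1) h ⟩
    (J ^ h) ^ ((h ℕ.+ h) ∸ 1)          ≈⟨ ^-congˡ ((h ℕ.+ h) ∸ 1) J^h≈L ⟩
    L ^ ((h ℕ.+ h) ∸ 1)                ≈⟨ ≈-reflexive (cong (L ^_) (odd-exponent h 1≤h)) ⟩
    L ^ suc (ℕ.pred h ℕ.+ ℕ.pred h)    ≈⟨ odd-power L²≈1 (ℕ.pred h) ⟩
    L                                  ∎
    where
    J minusTwo L : ZΔ
    J = ∏₁ (h ℕ.+ h) inv
    minusTwo = embed -[1+ 1 ]
    L = embed (legendre -[1+ 1 ] p)
    p∤2 : ¬ (p∣ -[1+ 1 ])
    p∤2 p∣-2 = ∤-small 2 (ℕ.s≤s ℕ.z≤n) (ℕ.s≤s (ℕP.+-mono-≤ 1≤h 1≤h)) (∣m⇒∣-m p∣-2)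
    L²≈1 : L ⊛ L ≈ oneZΔ
    L²≈1 = legendre-involution -[1+ 1 ] p∤2
    J·minusTwo≈1 : J ⊛ minusTwo ≈ oneZΔ
    J·minusTwo≈1 = ≈-trans (⊛-cong ≈-refl (≈-sym (product-t+√Δ p∤Δ (nonresidue-power p∤Δ nonsquare))))
                     (∏₁-inverse (h ℕ.+ h) inv tPlusSqrtΔ inverse)
    J^h≈L : J ^ h ≈ L
    J^h≈L = inverse-unique (begin
      J ^ h ⊛ L                ≈⟨ ⊛-cong ≈-refl (euler-criterion -[1+ 1 ] p∤2) ⟨
      J ^ h ⊛ minusTwo ^ h     ≈⟨ ^-distrib-* J minusTwo h ⟨
      (J ⊛ minusTwo) ^ h       ≈⟨ ≈-trans (^-congˡ h J·minusTwo≈1) (one^ h) ⟩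
      oneZΔ                    ∎) L²≈1

double : ∀ k → k ℕ.* 2 ≡ k ℕ.+ k
double k = trans (ℕP.*-comm k 2) (cong (k ℕ.+_) (ℕP.+-identityʳ k))

odd-prime-form : ∀ p → Prime p → p ≢ 2 → ∃[ h ] p ≡ suc (h ℕ.+ h)
odd-prime-form p isPrime p≢2 with p % 2 | m≡m%n+[m/n]*n p 2 | m%n<n p 2
... | 0 | p≡[p/2]*2 | _ with prime⇒irreducible isPrime (ℕD.divides (p / 2) p≡[p/2]*2)
...   | inj₁ ()
...   | inj₂ 2≡p = ⊥-elim (p≢2 (sym 2≡p))
odd-prime-form p isPrime p≢2 | 1 | p≡1+[p/2]*2 | _ = p / 2 , trans p≡1+[p/2]*2 (cong suc (double (p / 2)))
odd-prime-form p isPrime p≢2 | suc (suc _) | _ | ℕ.s≤s (ℕ.s≤s ())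

half : ∀ h → (suc (h ℕ.+ h) ∸ 1) / 2 ≡ h
half h = trans (cong (_/ 2) (sym (double h))) (m*n/n≡m h 2)

lemma2p3 : (p : ℕ) → Prime p → p ≢ 2 →
    (Δ : ℤ) → Δ ℤ.% + 4 ≡ 3 → legendre Δ p ≡ -[1+ 0 ] →
    (inv : ℕ → ZΔ) →
    (∀ t → 1 ≤ t → t ≤ p ∸ 1 → mulZΔ Δ (inv t) (tPlusSqrtΔ t) ≡ oneZΔ [mod𝔭 p ]) →
    powZΔ Δ (Cp Δ p inv) ((p ∸ 1) / 2) ≡ embed (legendre (-[1+ 1 ]) p) [mod𝔭 p ]
lemma2p3 p isPrime p≢2 Δ _ legendreΔ inv inverse with odd-prime-form p isPrime p≢2
lemma2p3 .(suc (h ℕ.+ h)) isPrime p≢2 Δ _ legendreΔ inv inverse | h , refl = ≈⇒mod𝔭 (begin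
  powZΔ Δ (Cp Δ p inv) ((p ∸ 1) / 2)   ≡⟨ cong (powZΔ Δ (Cp Δ p inv)) (half h) ⟩
  powZΔ Δ (Cp Δ p inv) h               ≡⟨ powZΔ-≡ (Cp Δ p inv) h ⟩
  Cp Δ p inv ^ h                       ≈⟨ Cp-power inv inverse′ (proj₁ nonresidueΔ) (proj₂ nonresidueΔ) ⟩
  embed (legendre -[1+ 1 ] p)          ∎)
  where
  open PrimeModulus (h ℕ.+ h) Δ isPrime using (p)
  open QuotientRing p Δ
  open Products p Δ
  open LegendreSymbol p
  open OddPrime h Δ isPrime
  open import Relation.Binary.Reasoning.Setoid setoid
  nonresidueΔ : ¬ (p∣ Δ) × NonSquare Δ
  nonresidueΔ = legendre≡-1 legendreΔ
  inverse′ : ∀ t → 1 ≤ t → t ≤ h ℕ.+ h → inv t ⊛ tPlusSqrtΔ t ≈ oneZΔ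
  inverse′ t 1≤t t≤m = ≈-trans (≈-reflexive (⊛-unfold (inv t) (tPlusSqrtΔ t))) (mod𝔭⇒≈ (inverse t 1≤t t≤m))
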